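{- Let $\tau:\Sigma\to\Sigma'$ be a syntactic translation between second-order signatures. Then its extension to terms commutes with substitution and metasubstitution: $\tau(t[t_i/x_i]_{i})=\tau(t)[\tau(t_i)/x_i]_{i}$ for all terms $\Theta\rhd x_1,\dots,x_n\vdash t$ and $\Theta\rhd\Gamma\vdash t_i$ over $\Sigma$, and $\tau(t\{\mathsf{m}_i:=(\vec x_i)t_i\}_{i})=\tau(t)\{\mathsf{m}_i:=(\vec x_i)\tau(t_i)\}_{i}$ for all terms $\mathsf{m}_1:[m_1],\dots,\mathsf{m}_k:[m_k]\rhd\Gamma\vdash t$ and $\Theta\rhd\Gamma,\vec x_i\vdash t_i$ ($|\vec x_i|=m_i$) over $\Sigma$.
   Context: A (unityped second-order) signature $\Sigma$ is a set of operators each with an arity $\mathsf{o}:\langle n_1,\dots,n_k\rangle\in\mathbb{N}^*$ ($k$ arguments, the $i$-th binding $n_i$ variables). Terms $\Theta\rhd\Gamma\vdash t$, in a context of metavariables $\Theta=(\mathsf{m}_1:[m_1],\dots,\mathsf{m}_k:[m_k])$ with natural-number arities and variables $\Gamma$, are generated by: $x\in\Gamma$; $\mathsf{m}[t_1,\dots,t_m]$ for $(\mathsf{m}:[m])\in\Theta$; $\mathsf{o}((\vec x_1)t_1,\dots,(\vec x_k)t_k)$ with $\Theta\rhd\Gamma,\vec x_i\vdash t_i$, $|\vec x_i|=n_i$, $\vec x_i$ bound in $t_i$; modulo $\alpha$-equivalence. $t[t_i/x_i]_i$ is capture-avoiding simultaneous substitution of terms for variables (acting inside metavariable arguments and under binders).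 Metasubstitution $t\{\mathsf{m}_i:=(\vec x_i)t_i\}_i$ is defined by $x\mapsto x$; $\mathsf{m}_\ell[s_1,\dots,s_{m_\ell}]\mapsto t_\ell[s'_j/x_{\ell,j}]_j$ with $s'_j=s_j\{\mathsf{m}_i:=(\vec x_i)t_i\}_i$; $\mathsf{o}(\dots,(\vec y)s,\dots)\mapsto\mathsf{o}(\dots,(\vec y)s\{\mathsf{m}_i:=(\vec x_i)t_i\}_i,\dots)$. A syntactic translation $\tau:\Sigma\to\Sigma'$ assigns to each operator $\mathsf{o}:\langle m_1,\dots,m_k\rangle$ of $\Sigma$ a term $\mathsf{m}_1:[m_1],\dots,\mathsf{m}_k:[m_k]\rhd\cdot\vdash\tau_{\mathsf{o}}$ over $\Sigma'$; its extension to terms is $\tau(x)=x$, $\tau(\mathsf{m}[t_1,\dots,t_m])=\mathsf{m}[\tau(t_1),\dots,\tau(t_m)]$, $\tau(\mathsf{o}((\vec x_1)t_1,\dots,(\vec x_k)t_k))=\tau_{\mathsf{o}}\{\mathsf{m}_i:=(\vec x_i)\tau(t_i)\}_{i\le k}$. -}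

module Defs where

open import Data.Nat using (ℕ; zero; suc; _+_)
open import Data.Fin using (Fin; zero; suc; _↑ˡ_; _↑ʳ_; splitAt)
open import Data.List using (List; []; _∷_)
open import Data.List.Membership.Propositional using (_∈_)
open import Data.List.Relation.Unary.Any using (here; there)
open import Data.Sum using (inj₁; inj₂)
open import Relation.Binary.PropositionalEquality using (refl)

-- A (unityped) second-order signature: operators with binding arities ⟨n₁,…,nₖ⟩.
record Signature : Set₁ where
  field
    Op : Set
    ar : Op → List ℕ
open Signature public

-- Well-scoped de Bruijn terms  Θ ▷ Γ ⊢ t  with Θ a list of metavariable arities
-- and Γ = n variables (Fin n).  α-equivalence is built in.
-- In an operator argument binding k variables the bound variables are the
-- first k indices of the context  k + n.
mutual
  data Tm (S : Signature) (Θ : List ℕ) (n : ℕ) : Set where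
    var  : Fin n → Tm S Θ n
    mvar : ∀ {m} → m ∈ Θ → Tms S Θ n m → Tm S Θ n
    op   : (o : Op S) → Args S Θ n (ar S o) → Tm S Θ n

  data Tms (S : Signature) (Θ : List ℕ) (n : ℕ) : ℕ → Set where
    []  : Tms S Θ n zero
    _∷_ : ∀ {m} → Tm S Θ n → Tms S Θ n m → Tms S Θ n (suc m)

  data Args (S : Signature) (Θ : List ℕ) (n : ℕ) : List ℕ → Set where
    []  : Args S Θ n []
    _∷_ : ∀ {k ks} → Tm S Θ (k + n) → Args S Θ n ks → Args S Θ n (k ∷ ks)

lookupTms : ∀ {S Θ n m} → Tms S Θ n m → Fin m → Tm S Θ n
lookupTms (t ∷ ts) zero    = t
lookupTms (t ∷ ts) (suc i) = lookupTms ts i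

liftR : ∀ {n p} (k : ℕ) → (Fin n → Fin p) → Fin (k + n) → Fin (k + p)
liftR {p = p} k ρ i with splitAt k i
... | inj₁ j = j ↑ˡ p
... | inj₂ j = k ↑ʳ ρ j

mutual
  rename : ∀ {S Θ n p} → (Fin n → Fin p) → Tm S Θ n → Tm S Θ p
  rename ρ (var i)     = var (ρ i)
  rename ρ (mvar x ts) = mvar x (renameTms ρ ts)
  rename ρ (op o as)   = op o (renameArgs ρ as)

  renameTms : ∀ {S Θ n p m} → (Fin n → Fin p) → Tms S Θ n m → Tms S Θ p m
  renameTms ρ []       = []
  renameTms ρ (t ∷ ts) = rename ρ t ∷ renameTms ρ ts

  renameArgs : ∀ {S Θ n p ks} → (Fin n → Fin p) → Args S Θ n ks → Args S Θ p ks
  renameArgs ρ []                 = []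
  renameArgs ρ (_∷_ {k} t as) = rename (liftR k ρ) t ∷ renameArgs ρ as

liftS : ∀ {S Θ n p} (k : ℕ) → (Fin n → Tm S Θ p) → Fin (k + n) → Tm S Θ (k + p)
liftS {p = p} k σ i with splitAt k i
... | inj₁ j = var (j ↑ˡ p)
... | inj₂ j = rename (k ↑ʳ_) (σ j)

mutual
  sub : ∀ {S Θ n p} → (Fin n → Tm S Θ p) → Tm S Θ n → Tm S Θ p
  sub σ (var i)     = σ i
  sub σ (mvar x ts) = mvar x (subTms σ ts)
  sub σ (op o as)   = op o (subArgs σ as)

  subTms : ∀ {S Θ n p m} → (Fin n → Tm S Θ p) → Tms S Θ n m → Tms S Θ p m
  subTms σ []       = []
  subTms σ (t ∷ ts) = sub σ t ∷ subTms σ ts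

  subArgs : ∀ {S Θ n p ks} → (Fin n → Tm S Θ p) → Args S Θ n ks → Args S Θ p ks
  subArgs σ []             = []
  subArgs σ (_∷_ {k} t as) = sub (liftS k σ) t ∷ subArgs σ as

-- Metasubstitution  t{𝔪 := (x⃗)ζ(𝔪)}_{𝔪 ∈ Θ}
-- ζ assigns to each metavariable 𝔪 : [m] of Θ a term  Θ' ▷ Γ, x₁…xₘ ⊢ ζ(𝔪)
-- (the m abstracted variables being the first m de Bruijn indices).

MetaSub : Signature → List ℕ → List ℕ → ℕ → Set
MetaSub S Θ Θ' n = ∀ {m} → m ∈ Θ → Tm S Θ' (m + n)

liftM : ∀ {S Θ Θ' n} (k : ℕ) → MetaSub S Θ Θ' n → MetaSub S Θ Θ' (k + n)
liftM k ζ {m} x = rename (liftR m (k ↑ʳ_)) (ζ x)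

instS : ∀ {S Θ n m} → Tms S Θ n m → Fin (m + n) → Tm S Θ n
instS {m = m} ts i with splitAt m i
... | inj₁ j = lookupTms ts j
... | inj₂ j = var j

mutual
  msub : ∀ {S Θ Θ' n} → MetaSub S Θ Θ' n → Tm S Θ n → Tm S Θ' n
  msub ζ (var i)     = var i
  msub ζ (mvar x ts) = sub (instS (msubTms ζ ts)) (ζ x)
  msub ζ (op o as)   = op o (msubArgs ζ as)

  msubTms : ∀ {S Θ Θ' n m} → MetaSub S Θ Θ' n → Tms S Θ n m → Tms S Θ' n m
  msubTms ζ []       = []
  msubTms ζ (t ∷ ts) = msub ζ t ∷ msubTms ζ ts

  msubArgs : ∀ {S Θ Θ' n ks} → MetaSub S Θ Θ' n → Args S Θ n ks → Args S Θ' n ks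
  msubArgs ζ []             = []
  msubArgs ζ (_∷_ {k} t as) = msub (liftM k ζ) t ∷ msubArgs ζ as

-- Syntactic translations  τ : Σ → Σ'
-- τ_o : 𝔪₁:[m₁],…,𝔪ₖ:[mₖ] ▷ · ⊢ τ_o  over Σ', for o : ⟨m₁,…,mₖ⟩.

Translation : Signature → Signature → Set
Translation S S' = (o : Op S) → Tm S' (ar S o) zero

emptyRen : ∀ {n} → Fin zero → Fin n
emptyRen ()

mutual
  ext : ∀ {S S' Θ n} → Translation S S' → Tm S Θ n → Tm S' Θ n
  ext τ (var i)     = var i
  ext τ (mvar x ts) = mvar x (extTms τ ts)
  ext {S} τ (op o as) = msub (extArgs τ as) (rename emptyRen (τ o))

  extTms : ∀ {S S' Θ n m} → Translation S S' → Tms S Θ n m → Tms S' Θ n m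
  extTms τ []       = []
  extTms τ (t ∷ ts) = ext τ t ∷ extTms τ ts

  extArgs : ∀ {S S' Θ n ks} → Translation S S' → Args S Θ n ks → MetaSub S' ks Θ n
  extArgs τ (t ∷ as) (here refl) = ext τ t
  extArgs τ (t ∷ as) (there x)   = extArgs τ as x

-- τ(o(t₁,…,tₖ)) is the metasubstitution instance τ_o{𝔪ᵢ := τ(tᵢ)} of a closed term,
-- so in the operator case both equations come down to the algebra of the two kinds of
-- substitution: substituting into τ_o{ζ} is metasubstituting τ_o by ζ[σ] (τ_o has no
-- free variables), and two metasubstitutions compose. Metavariable cases need the
-- converse law, that metasubstitution distributes over substitution; everything else
-- is induction on t.
module Submission where

open import Defs
open import Data.Nat using (zero; suc; _+_)
open import Data.Fin using (Fin; zero; suc; _↑ˡ_; _↑ʳ_)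
open import Data.Fin.Properties using (splitAt-↑ˡ; splitAt-↑ʳ)
open import Data.List.Membership.Propositional using (_∈_)
open import Data.List.Relation.Unary.Any using (here; there)
open import Data.Product using (_×_; _,_)
open import Function using (_∘_)
open import Relation.Binary.PropositionalEquality
open ≡-Reasoning

↑-≗ : ∀ k {n} {B : Set} {f g : Fin (k + n) → B} →
      (∀ j → f (j ↑ˡ n) ≡ g (j ↑ˡ n)) → (∀ j → f (k ↑ʳ j) ≡ g (k ↑ʳ j)) → f ≗ g
↑-≗ zero    l r i       = r i
↑-≗ (suc k) l r zero    = l zero
↑-≗ (suc k) {f = f} {g} l r (suc i) = ↑-≗ k {f = f ∘ suc} {g ∘ suc} (l ∘ suc) r i

liftR-↑ˡ : ∀ {n p} k (ρ : Fin n → Fin p) j → liftR k ρ (j ↑ˡ n) ≡ j ↑ˡ p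
liftR-↑ˡ {n} k ρ j rewrite splitAt-↑ˡ k j n = refl

liftR-↑ʳ : ∀ {n p} k (ρ : Fin n → Fin p) j → liftR k ρ (k ↑ʳ j) ≡ k ↑ʳ ρ j
liftR-↑ʳ {n} k ρ j rewrite splitAt-↑ʳ k n j = refl

liftS-↑ˡ : ∀ {S Θ n p} k (σ : Fin n → Tm S Θ p) j → liftS k σ (j ↑ˡ n) ≡ var (j ↑ˡ p)
liftS-↑ˡ {n = n} k σ j rewrite splitAt-↑ˡ k j n = refl

liftS-↑ʳ : ∀ {S Θ n p} k (σ : Fin n → Tm S Θ p) j → liftS k σ (k ↑ʳ j) ≡ rename (k ↑ʳ_) (σ j)
liftS-↑ʳ {n = n} k σ j rewrite splitAt-↑ʳ k n j = refl

instS-↑ˡ : ∀ {S Θ n m} (ts : Tms S Θ n m) j → instS ts (j ↑ˡ n) ≡ lookupTms ts j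
instS-↑ˡ {n = n} {m} ts j rewrite splitAt-↑ˡ m j n = refl

instS-↑ʳ : ∀ {S Θ n m} (ts : Tms S Θ n m) j → instS ts (m ↑ʳ j) ≡ var j
instS-↑ʳ {n = n} {m} ts j rewrite splitAt-↑ʳ m n j = refl

liftR-cong : ∀ {n p} k {ρ ρ' : Fin n → Fin p} → ρ ≗ ρ' → liftR k ρ ≗ liftR k ρ'
liftR-cong k {ρ} {ρ'} ρ≗ρ' = ↑-≗ k
  (λ j → trans (liftR-↑ˡ k ρ j) (sym (liftR-↑ˡ k ρ' j)))
  (λ j → trans (liftR-↑ʳ k ρ j) (trans (cong (k ↑ʳ_) (ρ≗ρ' j)) (sym (liftR-↑ʳ k ρ' j))))

mutual
  rename-cong : ∀ {S Θ n p} {ρ ρ' : Fin n → Fin p} → ρ ≗ ρ' →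
                (t : Tm S Θ n) → rename ρ t ≡ rename ρ' t
  rename-cong ρ≗ρ' (var i)     = cong var (ρ≗ρ' i)
  rename-cong ρ≗ρ' (mvar x ts) = cong (mvar x) (renameTms-cong ρ≗ρ' ts)
  rename-cong ρ≗ρ' (op o as)   = cong (op o) (renameArgs-cong ρ≗ρ' as)

  renameTms-cong : ∀ {S Θ n p m} {ρ ρ' : Fin n → Fin p} → ρ ≗ ρ' →
                   (ts : Tms S Θ n m) → renameTms ρ ts ≡ renameTms ρ' ts
  renameTms-cong ρ≗ρ' []       = refl
  renameTms-cong ρ≗ρ' (t ∷ ts) = cong₂ _∷_ (rename-cong ρ≗ρ' t) (renameTms-cong ρ≗ρ' ts)

  renameArgs-cong : ∀ {S Θ n p ks} {ρ ρ' : Fin n → Fin p} → ρ ≗ ρ' →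
                    (as : Args S Θ n ks) → renameArgs ρ as ≡ renameArgs ρ' as
  renameArgs-cong ρ≗ρ' []             = refl
  renameArgs-cong ρ≗ρ' (_∷_ {k} t as) =
    cong₂ _∷_ (rename-cong (liftR-cong k ρ≗ρ') t) (renameArgs-cong ρ≗ρ' as)

liftS-cong : ∀ {S Θ n p} k {σ σ' : Fin n → Tm S Θ p} → σ ≗ σ' → liftS k σ ≗ liftS k σ'
liftS-cong k {σ} {σ'} σ≗σ' = ↑-≗ k
  (λ j → trans (liftS-↑ˡ k σ j) (sym (liftS-↑ˡ k σ' j)))
  (λ j → trans (liftS-↑ʳ k σ j)
         (trans (cong (rename (k ↑ʳ_)) (σ≗σ' j)) (sym (liftS-↑ʳ k σ' j))))

mutual
  sub-cong : ∀ {S Θ n p} {σ σ' : Fin n → Tm S Θ p} → σ ≗ σ' →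
             (t : Tm S Θ n) → sub σ t ≡ sub σ' t
  sub-cong σ≗σ' (var i)     = σ≗σ' i
  sub-cong σ≗σ' (mvar x ts) = cong (mvar x) (subTms-cong σ≗σ' ts)
  sub-cong σ≗σ' (op o as)   = cong (op o) (subArgs-cong σ≗σ' as)

  subTms-cong : ∀ {S Θ n p m} {σ σ' : Fin n → Tm S Θ p} → σ ≗ σ' →
                (ts : Tms S Θ n m) → subTms σ ts ≡ subTms σ' ts
  subTms-cong σ≗σ' []       = refl
  subTms-cong σ≗σ' (t ∷ ts) = cong₂ _∷_ (sub-cong σ≗σ' t) (subTms-cong σ≗σ' ts)

  subArgs-cong : ∀ {S Θ n p ks} {σ σ' : Fin n → Tm S Θ p} → σ ≗ σ' →
                 (as : Args S Θ n ks) → subArgs σ as ≡ subArgs σ' as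
  subArgs-cong σ≗σ' []             = refl
  subArgs-cong σ≗σ' (_∷_ {k} t as) =
    cong₂ _∷_ (sub-cong (liftS-cong k σ≗σ') t) (subArgs-cong σ≗σ' as)

infix 4 _≐_

_≐_ : ∀ {S Θ Θ' n} → MetaSub S Θ Θ' n → MetaSub S Θ Θ' n → Set
_≐_ {Θ = Θ} ζ ζ' = ∀ {m} (x : m ∈ Θ) → ζ x ≡ ζ' x

mutual
  msub-cong : ∀ {S Θ Θ' n} {ζ ζ' : MetaSub S Θ Θ' n} → ζ ≐ ζ' →
              (t : Tm S Θ n) → msub ζ t ≡ msub ζ' t
  msub-cong ζ≐ζ' (var i)     = refl
  msub-cong ζ≐ζ' (mvar x ts) =
    cong₂ (λ us u → sub (instS us) u) (msubTms-cong ζ≐ζ' ts) (ζ≐ζ' x)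
  msub-cong ζ≐ζ' (op o as)   = cong (op o) (msubArgs-cong ζ≐ζ' as)

  msubTms-cong : ∀ {S Θ Θ' n m} {ζ ζ' : MetaSub S Θ Θ' n} → ζ ≐ ζ' →
                 (ts : Tms S Θ n m) → msubTms ζ ts ≡ msubTms ζ' ts
  msubTms-cong ζ≐ζ' []       = refl
  msubTms-cong ζ≐ζ' (t ∷ ts) = cong₂ _∷_ (msub-cong ζ≐ζ' t) (msubTms-cong ζ≐ζ' ts)

  msubArgs-cong : ∀ {S Θ Θ' n ks} {ζ ζ' : MetaSub S Θ Θ' n} → ζ ≐ ζ' →
                  (as : Args S Θ n ks) → msubArgs ζ as ≡ msubArgs ζ' as
  msubArgs-cong ζ≐ζ' []             = refl
  msubArgs-cong ζ≐ζ' (_∷_ {k} t as) =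
    cong₂ _∷_ (msub-cong (λ {m} x → cong (rename (liftR m (k ↑ʳ_))) (ζ≐ζ' x)) t)
              (msubArgs-cong ζ≐ζ' as)

-- Renaming and substitution

liftR-∘ : ∀ {n p q} k (ρ : Fin p → Fin q) (ρ' : Fin n → Fin p) →
          liftR k ρ ∘ liftR k ρ' ≗ liftR k (ρ ∘ ρ')
liftR-∘ k ρ ρ' = ↑-≗ k
  (λ j → begin
    liftR k ρ (liftR k ρ' (j ↑ˡ _)) ≡⟨ cong (liftR k ρ) (liftR-↑ˡ k ρ' j) ⟩
    liftR k ρ (j ↑ˡ _)              ≡⟨ liftR-↑ˡ k ρ j ⟩
    j ↑ˡ _                          ≡⟨ liftR-↑ˡ k (ρ ∘ ρ') j ⟨
    liftR k (ρ ∘ ρ') (j ↑ˡ _)       ∎)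
  (λ j → begin
    liftR k ρ (liftR k ρ' (k ↑ʳ j)) ≡⟨ cong (liftR k ρ) (liftR-↑ʳ k ρ' j) ⟩
    liftR k ρ (k ↑ʳ ρ' j)           ≡⟨ liftR-↑ʳ k ρ (ρ' j) ⟩
    k ↑ʳ ρ (ρ' j)                   ≡⟨ liftR-↑ʳ k (ρ ∘ ρ') j ⟨
    liftR k (ρ ∘ ρ') (k ↑ʳ j)       ∎)

mutual
  rename-rename : ∀ {S Θ n p q} (ρ : Fin p → Fin q) (ρ' : Fin n → Fin p) (t : Tm S Θ n) →
                  rename ρ (rename ρ' t) ≡ rename (ρ ∘ ρ') t
  rename-rename ρ ρ' (var i)     = refl
  rename-rename ρ ρ' (mvar x ts) = cong (mvar x) (renameTms-rename ρ ρ' ts)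
  rename-rename ρ ρ' (op o as)   = cong (op o) (renameArgs-rename ρ ρ' as)

  renameTms-rename : ∀ {S Θ n p q m} (ρ : Fin p → Fin q) (ρ' : Fin n → Fin p)
                     (ts : Tms S Θ n m) → renameTms ρ (renameTms ρ' ts) ≡ renameTms (ρ ∘ ρ') ts
  renameTms-rename ρ ρ' []       = refl
  renameTms-rename ρ ρ' (t ∷ ts) = cong₂ _∷_ (rename-rename ρ ρ' t) (renameTms-rename ρ ρ' ts)

  renameArgs-rename : ∀ {S Θ n p q ks} (ρ : Fin p → Fin q) (ρ' : Fin n → Fin p)
                      (as : Args S Θ n ks) → renameArgs ρ (renameArgs ρ' as) ≡ renameArgs (ρ ∘ ρ') as
  renameArgs-rename ρ ρ' []             = refl
  renameArgs-rename ρ ρ' (_∷_ {k} t as) =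
    cong₂ _∷_ (trans (rename-rename (liftR k ρ) (liftR k ρ') t) (rename-cong (liftR-∘ k ρ ρ') t))
              (renameArgs-rename ρ ρ' as)

liftR-liftS : ∀ {S Θ n p q} k (ρ : Fin p → Fin q) (σ : Fin n → Tm S Θ p) →
              rename (liftR k ρ) ∘ liftS k σ ≗ liftS k (rename ρ ∘ σ)
liftR-liftS k ρ σ = ↑-≗ k
  (λ j → begin
    rename (liftR k ρ) (liftS k σ (j ↑ˡ _)) ≡⟨ cong (rename (liftR k ρ)) (liftS-↑ˡ k σ j) ⟩
    var (liftR k ρ (j ↑ˡ _))                ≡⟨ cong var (liftR-↑ˡ k ρ j) ⟩
    var (j ↑ˡ _)                            ≡⟨ liftS-↑ˡ k (rename ρ ∘ σ) j ⟨
    liftS k (rename ρ ∘ σ) (j ↑ˡ _)         ∎)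
  (λ j → begin
    rename (liftR k ρ) (liftS k σ (k ↑ʳ j))   ≡⟨ cong (rename (liftR k ρ)) (liftS-↑ʳ k σ j) ⟩
    rename (liftR k ρ) (rename (k ↑ʳ_) (σ j)) ≡⟨ rename-rename (liftR k ρ) (k ↑ʳ_) (σ j) ⟩
    rename (liftR k ρ ∘ (k ↑ʳ_)) (σ j)        ≡⟨ rename-cong (liftR-↑ʳ k ρ) (σ j) ⟩
    rename ((k ↑ʳ_) ∘ ρ) (σ j)                ≡⟨ rename-rename (k ↑ʳ_) ρ (σ j) ⟨
    rename (k ↑ʳ_) (rename ρ (σ j))           ≡⟨ liftS-↑ʳ k (rename ρ ∘ σ) j ⟨
    liftS k (rename ρ ∘ σ) (k ↑ʳ j)           ∎)

mutual
  rename-sub : ∀ {S Θ n p q} (ρ : Fin p → Fin q) (σ : Fin n → Tm S Θ p) (t : Tm S Θ n) →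
               rename ρ (sub σ t) ≡ sub (rename ρ ∘ σ) t
  rename-sub ρ σ (var i)     = refl
  rename-sub ρ σ (mvar x ts) = cong (mvar x) (renameTms-sub ρ σ ts)
  rename-sub ρ σ (op o as)   = cong (op o) (renameArgs-sub ρ σ as)

  renameTms-sub : ∀ {S Θ n p q m} (ρ : Fin p → Fin q) (σ : Fin n → Tm S Θ p)
                  (ts : Tms S Θ n m) → renameTms ρ (subTms σ ts) ≡ subTms (rename ρ ∘ σ) ts
  renameTms-sub ρ σ []       = refl
  renameTms-sub ρ σ (t ∷ ts) = cong₂ _∷_ (rename-sub ρ σ t) (renameTms-sub ρ σ ts)

  renameArgs-sub : ∀ {S Θ n p q ks} (ρ : Fin p → Fin q) (σ : Fin n → Tm S Θ p)
                   (as : Args S Θ n ks) → renameArgs ρ (subArgs σ as) ≡ subArgs (rename ρ ∘ σ) as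
  renameArgs-sub ρ σ []             = refl
  renameArgs-sub ρ σ (_∷_ {k} t as) =
    cong₂ _∷_ (trans (rename-sub (liftR k ρ) (liftS k σ) t) (sub-cong (liftR-liftS k ρ σ) t))
              (renameArgs-sub ρ σ as)

liftS-liftR : ∀ {S Θ n p q} k (σ : Fin p → Tm S Θ q) (ρ : Fin n → Fin p) →
              liftS k σ ∘ liftR k ρ ≗ liftS k (σ ∘ ρ)
liftS-liftR k σ ρ = ↑-≗ k
  (λ j → trans (cong (liftS k σ) (liftR-↑ˡ k ρ j))
         (trans (liftS-↑ˡ k σ j) (sym (liftS-↑ˡ k (σ ∘ ρ) j))))
  (λ j → trans (cong (liftS k σ) (liftR-↑ʳ k ρ j))
         (trans (liftS-↑ʳ k σ (ρ j)) (sym (liftS-↑ʳ k (σ ∘ ρ) j))))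

mutual
  sub-rename : ∀ {S Θ n p q} (σ : Fin p → Tm S Θ q) (ρ : Fin n → Fin p) (t : Tm S Θ n) →
               sub σ (rename ρ t) ≡ sub (σ ∘ ρ) t
  sub-rename σ ρ (var i)     = refl
  sub-rename σ ρ (mvar x ts) = cong (mvar x) (subTms-rename σ ρ ts)
  sub-rename σ ρ (op o as)   = cong (op o) (subArgs-rename σ ρ as)

  subTms-rename : ∀ {S Θ n p q m} (σ : Fin p → Tm S Θ q) (ρ : Fin n → Fin p)
                  (ts : Tms S Θ n m) → subTms σ (renameTms ρ ts) ≡ subTms (σ ∘ ρ) ts
  subTms-rename σ ρ []       = refl
  subTms-rename σ ρ (t ∷ ts) = cong₂ _∷_ (sub-rename σ ρ t) (subTms-rename σ ρ ts)

  subArgs-rename : ∀ {S Θ n p q ks} (σ : Fin p → Tm S Θ q) (ρ : Fin n → Fin p)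
                   (as : Args S Θ n ks) → subArgs σ (renameArgs ρ as) ≡ subArgs (σ ∘ ρ) as
  subArgs-rename σ ρ []             = refl
  subArgs-rename σ ρ (_∷_ {k} t as) =
    cong₂ _∷_ (trans (sub-rename (liftS k σ) (liftR k ρ) t) (sub-cong (liftS-liftR k σ ρ) t))
              (subArgs-rename σ ρ as)

liftS-sub : ∀ {S Θ n p q} k (σ : Fin p → Tm S Θ q) (σ' : Fin n → Tm S Θ p) →
            sub (liftS k σ) ∘ liftS k σ' ≗ liftS k (sub σ ∘ σ')
liftS-sub k σ σ' = ↑-≗ k
  (λ j → trans (cong (sub (liftS k σ)) (liftS-↑ˡ k σ' j))
         (trans (liftS-↑ˡ k σ j) (sym (liftS-↑ˡ k (sub σ ∘ σ') j))))
  (λ j → begin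
    sub (liftS k σ) (liftS k σ' (k ↑ʳ j))   ≡⟨ cong (sub (liftS k σ)) (liftS-↑ʳ k σ' j) ⟩
    sub (liftS k σ) (rename (k ↑ʳ_) (σ' j)) ≡⟨ sub-rename (liftS k σ) (k ↑ʳ_) (σ' j) ⟩
    sub (liftS k σ ∘ (k ↑ʳ_)) (σ' j)        ≡⟨ sub-cong (liftS-↑ʳ k σ) (σ' j) ⟩
    sub (rename (k ↑ʳ_) ∘ σ) (σ' j)         ≡⟨ rename-sub (k ↑ʳ_) σ (σ' j) ⟨
    rename (k ↑ʳ_) (sub σ (σ' j))           ≡⟨ liftS-↑ʳ k (sub σ ∘ σ') j ⟨
    liftS k (sub σ ∘ σ') (k ↑ʳ j)           ∎)

mutual
  sub-sub : ∀ {S Θ n p q} (σ : Fin p → Tm S Θ q) (σ' : Fin n → Tm S Θ p) (t : Tm S Θ n) →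
            sub σ (sub σ' t) ≡ sub (sub σ ∘ σ') t
  sub-sub σ σ' (var i)     = refl
  sub-sub σ σ' (mvar x ts) = cong (mvar x) (subTms-sub σ σ' ts)
  sub-sub σ σ' (op o as)   = cong (op o) (subArgs-sub σ σ' as)

  subTms-sub : ∀ {S Θ n p q m} (σ : Fin p → Tm S Θ q) (σ' : Fin n → Tm S Θ p)
               (ts : Tms S Θ n m) → subTms σ (subTms σ' ts) ≡ subTms (sub σ ∘ σ') ts
  subTms-sub σ σ' []       = refl
  subTms-sub σ σ' (t ∷ ts) = cong₂ _∷_ (sub-sub σ σ' t) (subTms-sub σ σ' ts)

  subArgs-sub : ∀ {S Θ n p q ks} (σ : Fin p → Tm S Θ q) (σ' : Fin n → Tm S Θ p)
                (as : Args S Θ n ks) → subArgs σ (subArgs σ' as) ≡ subArgs (sub σ ∘ σ') as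
  subArgs-sub σ σ' []             = refl
  subArgs-sub σ σ' (_∷_ {k} t as) =
    cong₂ _∷_ (trans (sub-sub (liftS k σ) (liftS k σ') t) (sub-cong (liftS-sub k σ σ') t))
              (subArgs-sub σ σ' as)

liftS-var∘ : ∀ {S Θ n p} k {σ : Fin n → Tm S Θ p} {ρ : Fin n → Fin p} →
             σ ≗ var ∘ ρ → liftS k σ ≗ var ∘ liftR k ρ
liftS-var∘ k {σ} {ρ} σ≗ρ = ↑-≗ k
  (λ j → trans (liftS-↑ˡ k σ j) (sym (cong var (liftR-↑ˡ k ρ j))))
  (λ j → trans (liftS-↑ʳ k σ j)
         (trans (cong (rename (k ↑ʳ_)) (σ≗ρ j)) (sym (cong var (liftR-↑ʳ k ρ j)))))

liftS-var : ∀ {S Θ n} k {σ : Fin n → Tm S Θ n} → σ ≗ var → liftS k σ ≗ var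
liftS-var k {σ} σ≗var = ↑-≗ k
  (liftS-↑ˡ k σ)
  (λ j → trans (liftS-↑ʳ k σ j) (cong (rename (k ↑ʳ_)) (σ≗var j)))

mutual
  sub-var : ∀ {S Θ n} {σ : Fin n → Tm S Θ n} → σ ≗ var → (t : Tm S Θ n) → sub σ t ≡ t
  sub-var σ≗var (var i)     = σ≗var i
  sub-var σ≗var (mvar x ts) = cong (mvar x) (subTms-var σ≗var ts)
  sub-var σ≗var (op o as)   = cong (op o) (subArgs-var σ≗var as)

  subTms-var : ∀ {S Θ n m} {σ : Fin n → Tm S Θ n} → σ ≗ var →
               (ts : Tms S Θ n m) → subTms σ ts ≡ ts
  subTms-var σ≗var []       = refl
  subTms-var σ≗var (t ∷ ts) = cong₂ _∷_ (sub-var σ≗var t) (subTms-var σ≗var ts)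

  subArgs-var : ∀ {S Θ n ks} {σ : Fin n → Tm S Θ n} → σ ≗ var →
                (as : Args S Θ n ks) → subArgs σ as ≡ as
  subArgs-var σ≗var []             = refl
  subArgs-var σ≗var (_∷_ {k} t as) =
    cong₂ _∷_ (sub-var (liftS-var k σ≗var) t) (subArgs-var σ≗var as)

sub-rename-inverse : ∀ {S Θ n p} {σ : Fin p → Tm S Θ n} {ρ : Fin n → Fin p} →
                     σ ∘ ρ ≗ var → (t : Tm S Θ n) → sub σ (rename ρ t) ≡ t
sub-rename-inverse {σ = σ} {ρ} σρ≗var t = trans (sub-rename σ ρ t) (sub-var σρ≗var t)

-- Instantiating the abstracted variables of a metavariable

lookup-rename : ∀ {S Θ n p m} (ρ : Fin n → Fin p) (ts : Tms S Θ n m) j →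
                lookupTms (renameTms ρ ts) j ≡ rename ρ (lookupTms ts j)
lookup-rename ρ (t ∷ ts) zero    = refl
lookup-rename ρ (t ∷ ts) (suc j) = lookup-rename ρ ts j

lookup-sub : ∀ {S Θ n p m} (σ : Fin n → Tm S Θ p) (ts : Tms S Θ n m) j →
             lookupTms (subTms σ ts) j ≡ sub σ (lookupTms ts j)
lookup-sub σ (t ∷ ts) zero    = refl
lookup-sub σ (t ∷ ts) (suc j) = lookup-sub σ ts j

lookup-msub : ∀ {S Θ Θ' n m} (ζ : MetaSub S Θ Θ' n) (ts : Tms S Θ n m) j →
              lookupTms (msubTms ζ ts) j ≡ msub ζ (lookupTms ts j)
lookup-msub ζ (t ∷ ts) zero    = refl
lookup-msub ζ (t ∷ ts) (suc j) = lookup-msub ζ ts j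

instS-rename : ∀ {S Θ n p m} (ρ : Fin n → Fin p) (ts : Tms S Θ n m) →
               rename ρ ∘ instS ts ≗ instS (renameTms ρ ts) ∘ liftR m ρ
instS-rename {m = m} ρ ts = ↑-≗ m
  (λ j → begin
    rename ρ (instS ts (j ↑ˡ _))            ≡⟨ cong (rename ρ) (instS-↑ˡ ts j) ⟩
    rename ρ (lookupTms ts j)               ≡⟨ lookup-rename ρ ts j ⟨
    lookupTms (renameTms ρ ts) j            ≡⟨ instS-↑ˡ (renameTms ρ ts) j ⟨
    instS (renameTms ρ ts) (j ↑ˡ _)         ≡⟨ cong (instS (renameTms ρ ts)) (liftR-↑ˡ m ρ j) ⟨
    instS (renameTms ρ ts) (liftR m ρ (j ↑ˡ _)) ∎)
  (λ j → begin
    rename ρ (instS ts (m ↑ʳ j))            ≡⟨ cong (rename ρ) (instS-↑ʳ ts j) ⟩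
    var (ρ j)                               ≡⟨ instS-↑ʳ (renameTms ρ ts) (ρ j) ⟨
    instS (renameTms ρ ts) (m ↑ʳ ρ j)       ≡⟨ cong (instS (renameTms ρ ts)) (liftR-↑ʳ m ρ j) ⟨
    instS (renameTms ρ ts) (liftR m ρ (m ↑ʳ j)) ∎)

instS-sub : ∀ {S Θ n p m} (σ : Fin n → Tm S Θ p) (ts : Tms S Θ n m) →
            sub σ ∘ instS ts ≗ sub (instS (subTms σ ts)) ∘ liftS m σ
instS-sub {m = m} σ ts = ↑-≗ m
  (λ j → begin
    sub σ (instS ts (j ↑ˡ _))                     ≡⟨ cong (sub σ) (instS-↑ˡ ts j) ⟩
    sub σ (lookupTms ts j)                        ≡⟨ lookup-sub σ ts j ⟨
    lookupTms (subTms σ ts) j                     ≡⟨ instS-↑ˡ (subTms σ ts) j ⟨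
    sub (instS (subTms σ ts)) (var (j ↑ˡ _))      ≡⟨ cong (sub (instS (subTms σ ts))) (liftS-↑ˡ m σ j) ⟨
    sub (instS (subTms σ ts)) (liftS m σ (j ↑ˡ _)) ∎)
  (λ j → begin
    sub σ (instS ts (m ↑ʳ j))                         ≡⟨ cong (sub σ) (instS-↑ʳ ts j) ⟩
    σ j                                               ≡⟨ sub-rename-inverse (instS-↑ʳ (subTms σ ts)) (σ j) ⟨
    sub (instS (subTms σ ts)) (rename (m ↑ʳ_) (σ j))  ≡⟨ cong (sub (instS (subTms σ ts))) (liftS-↑ʳ m σ j) ⟨
    sub (instS (subTms σ ts)) (liftS m σ (m ↑ʳ j))    ∎)

instS-msub : ∀ {S Θ Θ' n m} (ζ : MetaSub S Θ Θ' n) (ts : Tms S Θ n m) →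
             msub ζ ∘ instS ts ≗ instS (msubTms ζ ts)
instS-msub {m = m} ζ ts = ↑-≗ m
  (λ j → begin
    msub ζ (instS ts (j ↑ˡ _))  ≡⟨ cong (msub ζ) (instS-↑ˡ ts j) ⟩
    msub ζ (lookupTms ts j)     ≡⟨ lookup-msub ζ ts j ⟨
    lookupTms (msubTms ζ ts) j  ≡⟨ instS-↑ˡ (msubTms ζ ts) j ⟨
    instS (msubTms ζ ts) (j ↑ˡ _) ∎)
  (λ j → trans (cong (msub ζ) (instS-↑ʳ ts j)) (sym (instS-↑ʳ (msubTms ζ ts) j)))

-- Metasubstitution

-- liftM k ζ is definitionally renameM (k ↑ʳ_) ζ.
renameM : ∀ {S Θ Θ' n p} → (Fin n → Fin p) → MetaSub S Θ Θ' n → MetaSub S Θ Θ' p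
renameM ρ ζ {m} x = rename (liftR m ρ) (ζ x)

subM : ∀ {S Θ Θ' n p} → (Fin n → Tm S Θ' p) → MetaSub S Θ Θ' n → MetaSub S Θ Θ' p
subM σ ζ {m} x = sub (liftS m σ) (ζ x)

msubM : ∀ {S Θ₀ Θ₁ Θ₂ n} → MetaSub S Θ₁ Θ₂ n → MetaSub S Θ₀ Θ₁ n → MetaSub S Θ₀ Θ₂ n
msubM ζ' ζ {m} x = msub (liftM m ζ') (ζ x)

liftM-renameM : ∀ {S Θ Θ' n p} k (ρ : Fin n → Fin p) (ζ : MetaSub S Θ Θ' n) →
                liftM k (renameM ρ ζ) ≐ renameM (liftR k ρ) (liftM k ζ)
liftM-renameM k ρ ζ {m} x = begin
  rename (liftR m (k ↑ʳ_)) (rename (liftR m ρ) (ζ x))      ≡⟨ rename-rename _ _ (ζ x) ⟩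
  rename (liftR m (k ↑ʳ_) ∘ liftR m ρ) (ζ x)               ≡⟨ rename-cong commute (ζ x) ⟩
  rename (liftR m (liftR k ρ) ∘ liftR m (k ↑ʳ_)) (ζ x)     ≡⟨ rename-rename _ _ (ζ x) ⟨
  rename (liftR m (liftR k ρ)) (rename (liftR m (k ↑ʳ_)) (ζ x)) ∎
  where
  commute : liftR m (k ↑ʳ_) ∘ liftR m ρ ≗ liftR m (liftR k ρ) ∘ liftR m (k ↑ʳ_)
  commute i = begin
    liftR m (k ↑ʳ_) (liftR m ρ i)            ≡⟨ liftR-∘ m (k ↑ʳ_) ρ i ⟩
    liftR m ((k ↑ʳ_) ∘ ρ) i                  ≡⟨ liftR-cong m (liftR-↑ʳ k ρ) i ⟨
    liftR m (liftR k ρ ∘ (k ↑ʳ_)) i          ≡⟨ liftR-∘ m (liftR k ρ) (k ↑ʳ_) i ⟨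
    liftR m (liftR k ρ) (liftR m (k ↑ʳ_) i)  ∎

liftM-subM : ∀ {S Θ Θ' n p} k (σ : Fin n → Tm S Θ' p) (ζ : MetaSub S Θ Θ' n) →
             liftM k (subM σ ζ) ≐ subM (liftS k σ) (liftM k ζ)
liftM-subM k σ ζ {m} x = begin
  rename (liftR m (k ↑ʳ_)) (sub (liftS m σ) (ζ x))           ≡⟨ rename-sub _ _ (ζ x) ⟩
  sub (rename (liftR m (k ↑ʳ_)) ∘ liftS m σ) (ζ x)           ≡⟨ sub-cong (liftR-liftS m (k ↑ʳ_) σ) (ζ x) ⟩
  sub (liftS m (rename (k ↑ʳ_) ∘ σ)) (ζ x)                   ≡⟨ sub-cong (liftS-cong m (liftS-↑ʳ k σ)) (ζ x) ⟨
  sub (liftS m (liftS k σ ∘ (k ↑ʳ_))) (ζ x)                  ≡⟨ sub-cong (liftS-liftR m (liftS k σ) (k ↑ʳ_)) (ζ x) ⟨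
  sub (liftS m (liftS k σ) ∘ liftR m (k ↑ʳ_)) (ζ x)          ≡⟨ sub-rename _ _ (ζ x) ⟨
  sub (liftS m (liftS k σ)) (rename (liftR m (k ↑ʳ_)) (ζ x)) ∎

mutual
  rename-msub : ∀ {S Θ₀ Θ n p} (ρ : Fin n → Fin p) (ζ : MetaSub S Θ₀ Θ n) (t : Tm S Θ₀ n) →
                rename ρ (msub ζ t) ≡ msub (renameM ρ ζ) (rename ρ t)
  rename-msub ρ ζ (var i)             = refl
  rename-msub ρ ζ (mvar {m} x ts) = begin
    rename ρ (sub (instS A) (ζ x))                ≡⟨ rename-sub ρ (instS A) (ζ x) ⟩
    sub (rename ρ ∘ instS A) (ζ x)                ≡⟨ sub-cong (instS-rename ρ A) (ζ x) ⟩
    sub (instS (renameTms ρ A) ∘ liftR m ρ) (ζ x) ≡⟨ sub-rename (instS (renameTms ρ A)) (liftR m ρ) (ζ x) ⟨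
    sub (instS (renameTms ρ A)) (renameM ρ ζ x)   ≡⟨ cong (λ us → sub (instS us) (renameM ρ ζ x))
                                                          (renameTms-msub ρ ζ ts) ⟩
    sub (instS (msubTms (renameM ρ ζ) (renameTms ρ ts))) (renameM ρ ζ x) ∎
    where A = msubTms ζ ts
  rename-msub ρ ζ (op o as)           = cong (op o) (renameArgs-msub ρ ζ as)

  renameTms-msub : ∀ {S Θ₀ Θ n p m} (ρ : Fin n → Fin p) (ζ : MetaSub S Θ₀ Θ n)
                   (ts : Tms S Θ₀ n m) →
                   renameTms ρ (msubTms ζ ts) ≡ msubTms (renameM ρ ζ) (renameTms ρ ts)
  renameTms-msub ρ ζ []       = refl
  renameTms-msub ρ ζ (t ∷ ts) = cong₂ _∷_ (rename-msub ρ ζ t) (renameTms-msub ρ ζ ts)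

  renameArgs-msub : ∀ {S Θ₀ Θ n p ks} (ρ : Fin n → Fin p) (ζ : MetaSub S Θ₀ Θ n)
                    (as : Args S Θ₀ n ks) →
                    renameArgs ρ (msubArgs ζ as) ≡ msubArgs (renameM ρ ζ) (renameArgs ρ as)
  renameArgs-msub ρ ζ []             = refl
  renameArgs-msub ρ ζ (_∷_ {k} t as) =
    cong₂ _∷_ (trans (rename-msub (liftR k ρ) (liftM k ζ) t)
                     (msub-cong (λ x → sym (liftM-renameM k ρ ζ x)) (rename (liftR k ρ) t)))
              (renameArgs-msub ρ ζ as)

-- Stated for a renamed term rename ρ u, since in the case of interest u is a closed
-- term weakened into context n, for which no substitution on the Θ₀ side exists.
mutual
  sub-msub : ∀ {S Θ₀ Θ n₀ n p} (σ : Fin n → Tm S Θ p) (ζ : MetaSub S Θ₀ Θ n)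
             {ρ : Fin n₀ → Fin n} {ρ' : Fin n₀ → Fin p} → σ ∘ ρ ≗ var ∘ ρ' →
             (u : Tm S Θ₀ n₀) → sub σ (msub ζ (rename ρ u)) ≡ msub (subM σ ζ) (rename ρ' u)
  sub-msub σ ζ σρ≗ρ' (var i)         = σρ≗ρ' i
  sub-msub σ ζ {ρ} {ρ'} σρ≗ρ' (mvar {m} x ts) = begin
    sub σ (sub (instS A) (ζ x))                    ≡⟨ sub-sub σ (instS A) (ζ x) ⟩
    sub (sub σ ∘ instS A) (ζ x)                    ≡⟨ sub-cong (instS-sub σ A) (ζ x) ⟩
    sub (sub (instS (subTms σ A)) ∘ liftS m σ) (ζ x) ≡⟨ sub-sub (instS (subTms σ A)) (liftS m σ) (ζ x) ⟨
    sub (instS (subTms σ A)) (subM σ ζ x)          ≡⟨ cong (λ us → sub (instS us) (subM σ ζ x))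
                                                           (subTms-msub σ ζ σρ≗ρ' ts) ⟩
    sub (instS (msubTms (subM σ ζ) (renameTms ρ' ts))) (subM σ ζ x) ∎
    where A = msubTms ζ (renameTms ρ ts)
  sub-msub σ ζ σρ≗ρ' (op o as)       = cong (op o) (subArgs-msub σ ζ σρ≗ρ' as)

  subTms-msub : ∀ {S Θ₀ Θ n₀ n p m} (σ : Fin n → Tm S Θ p) (ζ : MetaSub S Θ₀ Θ n)
                {ρ : Fin n₀ → Fin n} {ρ' : Fin n₀ → Fin p} → σ ∘ ρ ≗ var ∘ ρ' →
                (ts : Tms S Θ₀ n₀ m) →
                subTms σ (msubTms ζ (renameTms ρ ts)) ≡ msubTms (subM σ ζ) (renameTms ρ' ts)
  subTms-msub σ ζ σρ≗ρ' []       = refl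
  subTms-msub σ ζ σρ≗ρ' (t ∷ ts) =
    cong₂ _∷_ (sub-msub σ ζ σρ≗ρ' t) (subTms-msub σ ζ σρ≗ρ' ts)

  subArgs-msub : ∀ {S Θ₀ Θ n₀ n p ks} (σ : Fin n → Tm S Θ p) (ζ : MetaSub S Θ₀ Θ n)
                 {ρ : Fin n₀ → Fin n} {ρ' : Fin n₀ → Fin p} → σ ∘ ρ ≗ var ∘ ρ' →
                 (as : Args S Θ₀ n₀ ks) →
                 subArgs σ (msubArgs ζ (renameArgs ρ as)) ≡ msubArgs (subM σ ζ) (renameArgs ρ' as)
  subArgs-msub σ ζ σρ≗ρ' []             = refl
  subArgs-msub σ ζ {ρ} {ρ'} σρ≗ρ' (_∷_ {k} t as) =
    cong₂ _∷_ (trans (sub-msub (liftS k σ) (liftM k ζ) lifted t)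
                     (msub-cong (λ x → sym (liftM-subM k σ ζ x)) (rename (liftR k ρ') t)))
              (subArgs-msub σ ζ σρ≗ρ' as)
    where
    lifted : liftS k σ ∘ liftR k ρ ≗ var ∘ liftR k ρ'
    lifted i = trans (liftS-liftR k σ ρ i) (liftS-var∘ k σρ≗ρ' i)

liftS-msub : ∀ {S Θ Θ' n q} k (ζ : MetaSub S Θ Θ' n)
             {σ : Fin q → Tm S Θ n} {σ' : Fin q → Tm S Θ' n} →
             σ' ≗ msub ζ ∘ σ → liftS k σ' ≗ msub (liftM k ζ) ∘ liftS k σ
liftS-msub k ζ {σ} {σ'} σ'≗ζσ = ↑-≗ k
  (λ j → trans (liftS-↑ˡ k σ' j) (sym (cong (msub (liftM k ζ)) (liftS-↑ˡ k σ j))))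
  (λ j → begin
    liftS k σ' (k ↑ʳ j)                        ≡⟨ liftS-↑ʳ k σ' j ⟩
    rename (k ↑ʳ_) (σ' j)                      ≡⟨ cong (rename (k ↑ʳ_)) (σ'≗ζσ j) ⟩
    rename (k ↑ʳ_) (msub ζ (σ j))              ≡⟨ rename-msub (k ↑ʳ_) ζ (σ j) ⟩
    msub (liftM k ζ) (rename (k ↑ʳ_) (σ j))    ≡⟨ cong (msub (liftM k ζ)) (liftS-↑ʳ k σ j) ⟨
    msub (liftM k ζ) (liftS k σ (k ↑ʳ j))      ∎)

mutual
  msub-sub : ∀ {S Θ Θ' n q} (ζ : MetaSub S Θ Θ' n) (σ : Fin q → Tm S Θ n)
             {ζ₀ : MetaSub S Θ Θ' q} {σ' : Fin q → Tm S Θ' n} →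
             σ' ≗ msub ζ ∘ σ → subM σ' ζ₀ ≐ ζ →
             (t : Tm S Θ q) → msub ζ (sub σ t) ≡ sub σ' (msub ζ₀ t)
  msub-sub ζ σ σ'≗ζσ σ'ζ₀≐ζ (var i)         = sym (σ'≗ζσ i)
  msub-sub ζ σ {ζ₀} {σ'} σ'≗ζσ σ'ζ₀≐ζ (mvar {m} x ts) = begin
    sub (instS A) (ζ x)                              ≡⟨ cong (sub (instS A)) (σ'ζ₀≐ζ x) ⟨
    sub (instS A) (sub (liftS m σ') (ζ₀ x))          ≡⟨ cong (λ us → sub (instS us) (subM σ' ζ₀ x))
                                                             (msubTms-sub ζ σ σ'≗ζσ σ'ζ₀≐ζ ts) ⟩
    sub (instS (subTms σ' B)) (sub (liftS m σ') (ζ₀ x)) ≡⟨ sub-sub (instS (subTms σ' B)) (liftS m σ') (ζ₀ x) ⟩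
    sub (sub (instS (subTms σ' B)) ∘ liftS m σ') (ζ₀ x) ≡⟨ sub-cong (instS-sub σ' B) (ζ₀ x) ⟨
    sub (sub σ' ∘ instS B) (ζ₀ x)                    ≡⟨ sub-sub σ' (instS B) (ζ₀ x) ⟨
    sub σ' (sub (instS B) (ζ₀ x))                    ∎
    where
    A = msubTms ζ (subTms σ ts)
    B = msubTms ζ₀ ts
  msub-sub ζ σ σ'≗ζσ σ'ζ₀≐ζ (op o as)       =
    cong (op o) (msubArgs-sub ζ σ σ'≗ζσ σ'ζ₀≐ζ as)

  msubTms-sub : ∀ {S Θ Θ' n q m} (ζ : MetaSub S Θ Θ' n) (σ : Fin q → Tm S Θ n)
                {ζ₀ : MetaSub S Θ Θ' q} {σ' : Fin q → Tm S Θ' n} →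
                σ' ≗ msub ζ ∘ σ → subM σ' ζ₀ ≐ ζ →
                (ts : Tms S Θ q m) → msubTms ζ (subTms σ ts) ≡ subTms σ' (msubTms ζ₀ ts)
  msubTms-sub ζ σ σ'≗ζσ σ'ζ₀≐ζ []       = refl
  msubTms-sub ζ σ σ'≗ζσ σ'ζ₀≐ζ (t ∷ ts) =
    cong₂ _∷_ (msub-sub ζ σ σ'≗ζσ σ'ζ₀≐ζ t) (msubTms-sub ζ σ σ'≗ζσ σ'ζ₀≐ζ ts)

  msubArgs-sub : ∀ {S Θ Θ' n q ks} (ζ : MetaSub S Θ Θ' n) (σ : Fin q → Tm S Θ n)
                 {ζ₀ : MetaSub S Θ Θ' q} {σ' : Fin q → Tm S Θ' n} →
                 σ' ≗ msub ζ ∘ σ → subM σ' ζ₀ ≐ ζ →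
                 (as : Args S Θ q ks) → msubArgs ζ (subArgs σ as) ≡ subArgs σ' (msubArgs ζ₀ as)
  msubArgs-sub ζ σ σ'≗ζσ σ'ζ₀≐ζ []             = refl
  msubArgs-sub ζ σ {ζ₀} {σ'} σ'≗ζσ σ'ζ₀≐ζ (_∷_ {k} t as) =
    cong₂ _∷_ (msub-sub (liftM k ζ) (liftS k σ) (liftS-msub k ζ σ'≗ζσ) lifted t)
              (msubArgs-sub ζ σ σ'≗ζσ σ'ζ₀≐ζ as)
    where
    lifted : subM (liftS k σ') (liftM k ζ₀) ≐ liftM k ζ
    lifted {m} x = trans (sym (liftM-subM k σ' ζ₀ x)) (cong (rename (liftR m (k ↑ʳ_))) (σ'ζ₀≐ζ x))

msub-instS : ∀ {S Θ Θ' n m} (ζ : MetaSub S Θ Θ' n) (ts : Tms S Θ n m) (t : Tm S Θ (m + n)) →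
             msub ζ (sub (instS ts) t) ≡ sub (instS (msubTms ζ ts)) (msub (liftM m ζ) t)
msub-instS {m = m} ζ ts =
  msub-sub ζ (instS ts) (λ i → sym (instS-msub ζ ts i))
    (λ {m'} y → sub-rename-inverse (weaken-then-instS m') (ζ y))
  where
  weaken-then-instS : ∀ m' → liftS m' (instS (msubTms ζ ts)) ∘ liftR m' (m ↑ʳ_) ≗ var
  weaken-then-instS m' i =
    trans (liftS-liftR m' _ (m ↑ʳ_) i) (liftS-var m' (instS-↑ʳ (msubTms ζ ts)) i)

liftM-msubM : ∀ {S Θ₀ Θ₁ Θ₂ n} k (ζ' : MetaSub S Θ₁ Θ₂ n) (ζ : MetaSub S Θ₀ Θ₁ n) →
              liftM k (msubM ζ' ζ) ≐ msubM (liftM k ζ') (liftM k ζ)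
liftM-msubM k ζ' ζ {m} x =
  trans (rename-msub (liftR m (k ↑ʳ_)) (liftM m ζ') (ζ x))
        (msub-cong (λ y → sym (liftM-renameM m (k ↑ʳ_) ζ' y)) (liftM k ζ x))

mutual
  msub-msub : ∀ {S Θ₀ Θ₁ Θ₂ n} (ζ' : MetaSub S Θ₁ Θ₂ n) (ζ : MetaSub S Θ₀ Θ₁ n)
              (t : Tm S Θ₀ n) → msub ζ' (msub ζ t) ≡ msub (msubM ζ' ζ) t
  msub-msub ζ' ζ (var i)         = refl
  msub-msub ζ' ζ (mvar {m} x ts) =
    trans (msub-instS ζ' (msubTms ζ ts) (ζ x))
          (cong (λ us → sub (instS us) (msubM ζ' ζ x)) (msubTms-msub ζ' ζ ts))
  msub-msub ζ' ζ (op o as)       = cong (op o) (msubArgs-msub ζ' ζ as)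

  msubTms-msub : ∀ {S Θ₀ Θ₁ Θ₂ n m} (ζ' : MetaSub S Θ₁ Θ₂ n) (ζ : MetaSub S Θ₀ Θ₁ n)
                 (ts : Tms S Θ₀ n m) → msubTms ζ' (msubTms ζ ts) ≡ msubTms (msubM ζ' ζ) ts
  msubTms-msub ζ' ζ []       = refl
  msubTms-msub ζ' ζ (t ∷ ts) = cong₂ _∷_ (msub-msub ζ' ζ t) (msubTms-msub ζ' ζ ts)

  msubArgs-msub : ∀ {S Θ₀ Θ₁ Θ₂ n ks} (ζ' : MetaSub S Θ₁ Θ₂ n) (ζ : MetaSub S Θ₀ Θ₁ n)
                  (as : Args S Θ₀ n ks) → msubArgs ζ' (msubArgs ζ as) ≡ msubArgs (msubM ζ' ζ) as
  msubArgs-msub ζ' ζ []             = refl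
  msubArgs-msub ζ' ζ (_∷_ {k} t as) =
    cong₂ _∷_ (trans (msub-msub (liftM k ζ') (liftM k ζ) t)
                     (msub-cong (λ x → sym (liftM-msubM k ζ' ζ x)) t))
              (msubArgs-msub ζ' ζ as)

-- Translations

rename-weakened-closed : ∀ {S Θ n p} (ρ : Fin n → Fin p) (u : Tm S Θ zero) →
                         rename ρ (rename emptyRen u) ≡ rename emptyRen u
rename-weakened-closed ρ u = trans (rename-rename ρ emptyRen u) (rename-cong (λ ()) u)

module _ {S S' : Signature} (τ : Translation S S') where

  lookup-ext : ∀ {Θ n m} (ts : Tms S Θ n m) j → lookupTms (extTms τ ts) j ≡ ext τ (lookupTms ts j)
  lookup-ext (t ∷ ts) zero    = refl
  lookup-ext (t ∷ ts) (suc j) = lookup-ext ts j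

  instS-ext : ∀ {Θ n m} (ts : Tms S Θ n m) → ext τ ∘ instS ts ≗ instS (extTms τ ts)
  instS-ext {m = m} ts = ↑-≗ m
    (λ j → begin
      ext τ (instS ts (j ↑ˡ _))    ≡⟨ cong (ext τ) (instS-↑ˡ ts j) ⟩
      ext τ (lookupTms ts j)       ≡⟨ lookup-ext ts j ⟨
      lookupTms (extTms τ ts) j    ≡⟨ instS-↑ˡ (extTms τ ts) j ⟨
      instS (extTms τ ts) (j ↑ˡ _) ∎)
    (λ j → trans (cong (ext τ) (instS-↑ʳ ts j)) (sym (instS-↑ʳ (extTms τ ts) j)))

  mutual
    ext-rename : ∀ {Θ n p} (ρ : Fin n → Fin p) (t : Tm S Θ n) →
                 ext τ (rename ρ t) ≡ rename ρ (ext τ t)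
    ext-rename ρ (var i)     = refl
    ext-rename ρ (mvar x ts) = cong (mvar x) (extTms-rename ρ ts)
    ext-rename ρ (op o as)   = begin
      msub (extArgs τ (renameArgs ρ as)) u         ≡⟨ msub-cong (extArgs-rename ρ as) u ⟩
      msub (renameM ρ (extArgs τ as)) u            ≡⟨ cong (msub (renameM ρ (extArgs τ as)))
                                                           (rename-weakened-closed ρ (τ o)) ⟨
      msub (renameM ρ (extArgs τ as)) (rename ρ u) ≡⟨ rename-msub ρ (extArgs τ as) u ⟨
      rename ρ (msub (extArgs τ as) u)             ∎
      where
      u : ∀ {k} → Tm S' (ar S o) k
      u = rename emptyRen (τ o)

    extTms-rename : ∀ {Θ n p m} (ρ : Fin n → Fin p) (ts : Tms S Θ n m) →
                    extTms τ (renameTms ρ ts) ≡ renameTms ρ (extTms τ ts)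
    extTms-rename ρ []       = refl
    extTms-rename ρ (t ∷ ts) = cong₂ _∷_ (ext-rename ρ t) (extTms-rename ρ ts)

    extArgs-rename : ∀ {Θ n p ks} (ρ : Fin n → Fin p) (as : Args S Θ n ks) →
                     extArgs τ (renameArgs ρ as) ≐ renameM ρ (extArgs τ as)
    extArgs-rename ρ (_∷_ {k} t as) (here refl) = ext-rename (liftR k ρ) t
    extArgs-rename ρ (t ∷ as)       (there x)   = extArgs-rename ρ as x

  ext-liftS : ∀ {Θ n p} k (σ : Fin n → Tm S Θ p) → ext τ ∘ liftS k σ ≗ liftS k (ext τ ∘ σ)
  ext-liftS k σ = ↑-≗ k
    (λ j → trans (cong (ext τ) (liftS-↑ˡ k σ j)) (sym (liftS-↑ˡ k (ext τ ∘ σ) j)))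
    (λ j → begin
      ext τ (liftS k σ (k ↑ʳ j))        ≡⟨ cong (ext τ) (liftS-↑ʳ k σ j) ⟩
      ext τ (rename (k ↑ʳ_) (σ j))      ≡⟨ ext-rename (k ↑ʳ_) (σ j) ⟩
      rename (k ↑ʳ_) (ext τ (σ j))      ≡⟨ liftS-↑ʳ k (ext τ ∘ σ) j ⟨
      liftS k (ext τ ∘ σ) (k ↑ʳ j)      ∎)

  mutual
    ext-sub : ∀ {Θ n p} (σ : Fin n → Tm S Θ p) (t : Tm S Θ n) →
              ext τ (sub σ t) ≡ sub (ext τ ∘ σ) (ext τ t)
    ext-sub σ (var i)     = refl
    ext-sub σ (mvar x ts) = cong (mvar x) (extTms-sub σ ts)
    ext-sub σ (op o as)   = begin
      msub (extArgs τ (subArgs σ as)) u        ≡⟨ msub-cong (extArgs-sub σ as) u ⟩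
      msub (subM (ext τ ∘ σ) (extArgs τ as)) u ≡⟨ sub-msub (ext τ ∘ σ) (extArgs τ as) (λ ()) (τ o) ⟨
      sub (ext τ ∘ σ) (msub (extArgs τ as) u)  ∎
      where
      u : ∀ {k} → Tm S' (ar S o) k
      u = rename emptyRen (τ o)

    extTms-sub : ∀ {Θ n p m} (σ : Fin n → Tm S Θ p) (ts : Tms S Θ n m) →
                 extTms τ (subTms σ ts) ≡ subTms (ext τ ∘ σ) (extTms τ ts)
    extTms-sub σ []       = refl
    extTms-sub σ (t ∷ ts) = cong₂ _∷_ (ext-sub σ t) (extTms-sub σ ts)

    extArgs-sub : ∀ {Θ n p ks} (σ : Fin n → Tm S Θ p) (as : Args S Θ n ks) →
                  extArgs τ (subArgs σ as) ≐ subM (ext τ ∘ σ) (extArgs τ as)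
    extArgs-sub σ (_∷_ {k} t as) (here refl) =
      trans (ext-sub (liftS k σ) t) (sub-cong (ext-liftS k σ) (ext τ t))
    extArgs-sub σ (t ∷ as)       (there x)   = extArgs-sub σ as x

  mutual
    ext-msub : ∀ {Θ₀ Θ n} (ζ : MetaSub S Θ₀ Θ n) (t : Tm S Θ₀ n) →
               ext τ (msub ζ t) ≡ msub (λ x → ext τ (ζ x)) (ext τ t)
    ext-msub ζ (var i)         = refl
    ext-msub ζ (mvar x ts)     = begin
      ext τ (sub (instS A) (ζ x))                  ≡⟨ ext-sub (instS A) (ζ x) ⟩
      sub (ext τ ∘ instS A) (ext τ (ζ x))          ≡⟨ sub-cong (instS-ext A) (ext τ (ζ x)) ⟩
      sub (instS (extTms τ A)) (ext τ (ζ x))       ≡⟨ cong (λ us → sub (instS us) (ext τ (ζ x))) (extTms-msub ζ ts) ⟩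
      sub (instS (msubTms (λ y → ext τ (ζ y)) (extTms τ ts))) (ext τ (ζ x)) ∎
      where A = msubTms ζ ts
    ext-msub ζ (op o as)       = begin
      msub (extArgs τ (msubArgs ζ as)) u                ≡⟨ msub-cong (extArgs-msub ζ as) u ⟩
      msub (msubM (λ x → ext τ (ζ x)) (extArgs τ as)) u ≡⟨ msub-msub (λ x → ext τ (ζ x)) (extArgs τ as) u ⟨
      msub (λ x → ext τ (ζ x)) (msub (extArgs τ as) u)  ∎
      where
      u : ∀ {k} → Tm S' (ar S o) k
      u = rename emptyRen (τ o)

    extTms-msub : ∀ {Θ₀ Θ n m} (ζ : MetaSub S Θ₀ Θ n) (ts : Tms S Θ₀ n m) →
                  extTms τ (msubTms ζ ts) ≡ msubTms (λ x → ext τ (ζ x)) (extTms τ ts)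
    extTms-msub ζ []       = refl
    extTms-msub ζ (t ∷ ts) = cong₂ _∷_ (ext-msub ζ t) (extTms-msub ζ ts)

    extArgs-msub : ∀ {Θ₀ Θ n ks} (ζ : MetaSub S Θ₀ Θ n) (as : Args S Θ₀ n ks) →
                   extArgs τ (msubArgs ζ as) ≐ msubM (λ x → ext τ (ζ x)) (extArgs τ as)
    extArgs-msub ζ (_∷_ {k} t as) (here refl) =
      trans (ext-msub (liftM k ζ) t) (msub-cong (λ {m} y → ext-rename (liftR m (k ↑ʳ_)) (ζ y)) (ext τ t))
    extArgs-msub ζ (t ∷ as)       (there x)   = extArgs-msub ζ as x

lemma3 : (S S' : Signature) (τ : Translation S S') →
    (∀ {Θ n p} (t : Tm S Θ n) (σ : Fin n → Tm S Θ p) →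
       ext τ (sub σ t) ≡ sub (λ i → ext τ (σ i)) (ext τ t))
    × (∀ {Θ₀ Θ n} (t : Tm S Θ₀ n) (ζ : MetaSub S Θ₀ Θ n) →
       ext τ (msub ζ t) ≡ msub (λ x → ext τ (ζ x)) (ext τ t))
lemma3 S S' τ = (λ t σ → ext-sub τ σ t) , (λ t ζ → ext-msub τ ζ t)
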